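{- Let $\Gamma$ be a simple graph of size $m$ whose two largest degrees (the first two terms of its non-increasing degree sequence) are $\delta_1\ge\delta_2$, and let ${\cal L}(\Gamma)$ be its line graph. Then $$\gamma_a({\cal L}(\Gamma))\ge\left\lceil\frac{2m}{\delta_1+\delta_2+1}\right\rceil\quad\text{and}\quad \gamma_{\hat a}({\cal L}(\Gamma))\ge\left\lceil\frac{2m}{\delta_1+\delta_2}\right\rceil.$$
   Context: For a graph $G=(V,E)$, a set $S\subseteq V$ and a vertex $v$, let $N_S(v)$ be the set of neighbours of $v$ in $S$ and $N_{V\setminus S}(v)$ the set of neighbours of $v$ in $V\setminus S$. A nonempty set $S\subseteq V$ is a defensive alliance if $|N_S(v)|+1\ge |N_{V\setminus S}(v)|$ for every $v\in S$, and a strong defensive alliance if $|N_S(v)|\ge|N_{V\setminus S}(v)|$ for every $v\in S$. A (strong) defensive alliance $S$ is global if every vertex of $V\setminus S$ is adjacent to at least one vertex of $S$. The global defensive alliance number $\gamma_a(G)$ (resp. global strong defensive alliance number $\gamma_{\hat a}(G)$) is the minimum cardinality of a global defensive alliance (resp. global strong defensive alliance) in $G$. The line graph ${\cal L}(\Gamma)$ has the edges of $\Gamma$ as vertices, two being adjacent when they share an endpoint. -}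

module Defs where

open import Data.Nat using (ℕ; zero; suc; _+_; _≤_; _<ᵇ_)
open import Data.Nat.DivMod using (_/_)
open import Data.Bool using (Bool; true; false; _∧_; _∨_; not; if_then_else_)
open import Data.Fin using (Fin; toℕ; _≟_)
open import Data.Fin.Subset using (Subset; _∈_; _∉_; _∩_; ∁; ∣_∣; Nonempty)
open import Data.Vec using (tabulate)
open import Data.List using (List; []; _∷_; concatMap; length; allFin; lookup)
open import Data.Product using (_×_; _,_; ∃; proj₁; proj₂)
open import Relation.Binary.PropositionalEquality using (_≡_)
open import Relation.Nullary.Decidable using (⌊_⌋)
open import Relation.Nullary using (¬_)

-- ceiling of a / b (for b ≥ 1); ⌈ a / 0 ⌉ is set to 0 by convention
ceilDiv : ℕ → ℕ → ℕ
ceilDiv a zero = zero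
ceilDiv a (suc b) = (a + b) / suc b

record SimpleGraph : Set where
  field
    n      : ℕ
    adj    : Fin n → Fin n → Bool
    sym    : ∀ i j → adj i j ≡ adj j i
    irrefl : ∀ i → adj i i ≡ false

module _ {k : ℕ} (adj : Fin k → Fin k → Bool) where

  N : Fin k → Subset k
  N v = tabulate (adj v)

  degIn : Subset k → Fin k → ℕ
  degIn S v = ∣ S ∩ N v ∣

  degOut : Subset k → Fin k → ℕ
  degOut S v = ∣ ∁ S ∩ N v ∣

  IsDefensiveAlliance : Subset k → Set
  IsDefensiveAlliance S =
    Nonempty S × (∀ v → v ∈ S → degOut S v ≤ degIn S v + 1)

  IsStrongDefensiveAlliance : Subset k → Set
  IsStrongDefensiveAlliance S =
    Nonempty S × (∀ v → v ∈ S → degOut S v ≤ degIn S v)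

  Dominating : Subset k → Set
  Dominating S = ∀ v → v ∉ S → ∃ λ u → u ∈ S × adj v u ≡ true

  IsGlobalDefensiveAlliance : Subset k → Set
  IsGlobalDefensiveAlliance S = IsDefensiveAlliance S × Dominating S

  IsGlobalStrongDefensiveAlliance : Subset k → Set
  IsGlobalStrongDefensiveAlliance S = IsStrongDefensiveAlliance S × Dominating S

module _ (Γ : SimpleGraph) where
  open SimpleGraph Γ

  degree : Fin n → ℕ
  degree v = ∣ N adj v ∣

  edgeList : List (Fin n × Fin n)
  edgeList = concatMap (λ i → concatMap (λ j →
               if (toℕ i <ᵇ toℕ j) ∧ adj i j then (i , j) ∷ [] else [])
               (allFin n)) (allFin n)

  size : ℕ
  size = length edgeList

  edge : Fin size → Fin n × Fin n
  edge e = lookup edgeList e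

  shareEnd : Fin n × Fin n → Fin n × Fin n → Bool
  shareEnd (a , b) (c , d) =
    ⌊ a ≟ c ⌋ ∨ ⌊ a ≟ d ⌋ ∨ ⌊ b ≟ c ⌋ ∨ ⌊ b ≟ d ⌋

  lineAdj : Fin size → Fin size → Bool
  lineAdj e f = not ⌊ e ≟ f ⌋ ∧ shareEnd (edge e) (edge f)

  -- δ₁ ≥ δ₂ are the first two terms of the non-increasing degree sequence of Γ:
  -- there are two distinct vertices u, w of degrees δ₁, δ₂ such that every
  -- vertex has degree ≤ δ₁ and every vertex other than u has degree ≤ δ₂.
  TopTwoDegrees : ℕ → ℕ → Set
  TopTwoDegrees δ₁ δ₂ = ∃ λ u → ∃ λ w →
    ¬ (u ≡ w) × degree u ≡ δ₁ × degree w ≡ δ₂ ×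
    (∀ x → degree x ≤ δ₁) × (∀ x → ¬ (x ≡ u) → degree x ≤ δ₂)

{-# OPTIONS --safe #-}

-- An edge ab of Γ has line-graph degree deg a + deg b - 2 (the edges at a vertex inject
-- into its neighbours via their other endpoint), and since a ≠ b only one of them can have
-- degree above δ₂, this is at most δ₁ + δ₂ - 2. For e in a global (strong) defensive
-- alliance S, 2 degOut(e) ≤ deg(e) + 1 (resp. deg(e)). Domination means every edge outside
-- S is an outside neighbour of some member of S, so m - |S| ≤ Σ_{e∈S} degOut(e) and
-- 2m ≤ Σ_{e∈S} (2 + 2 degOut(e)) ≤ |S| (δ₁ + δ₂ + 1) (resp. |S| (δ₁ + δ₂)).
module Submission where

open import Defs
open import Data.Bool using (Bool; true; false; if_then_else_; _∧_)
open import Data.Bool.Properties using (T-≡)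
open import Data.Fin using (Fin; zero; suc; toℕ; _<_; _≟_)
import Data.Fin.Properties as Fin
open import Data.Fin.Subset
  using (Subset; _∈_; _⊆_; _∩_; _∪_; _-_; ∁; ∣_∣; ⊥; inside; outside)
open import Data.Fin.Subset.Properties
  using (∣p∣≤n; ∣⊥∣≡0; ∣∁p∣≡n∸∣p∣; p⊆q⇒∣p∣≤∣q∣; x∈p⇒∣p-x∣<∣p∣;
         x∈p∧x≢y⇒x∈p-y; x∈p∩q⁺; x∈p∪q⁺; x∈∁p⇒x∉p)
open import Data.List using (List; []; _∷_; concatMap; allFin; lookup)
open import Data.List.Membership.Propositional using (find)
  renaming (_∈_ to _∈ˡ_)
open import Data.List.Membership.Propositional.Properties
  using (∈-concatMap⁻; ∈-lookup)
import Data.List.Relation.Unary.All as All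
open import Data.List.Relation.Unary.AllPairs using ([]; _∷_)
open import Data.List.Relation.Unary.Any as Any using (satisfied)
open import Data.List.Relation.Unary.Unique.Propositional using (Unique)
open import Data.List.Relation.Unary.Unique.Propositional.Properties
  using (++⁺; allFin⁺)
open import Data.Nat using (ℕ; zero; suc; _+_; _*_; _≤_; _<ᵇ_; z≤n; s≤s; s≤s⁻¹)
open import Data.Nat.DivMod using (m<n*o⇒m/o<n)
open import Data.Nat.Properties
  using (+-suc; +-comm; +-assoc; *-zeroʳ; *-distribˡ-+; m+[n∸m]≡n; n≤1+n; m≤m+n; n<1+n;
         ≤-reflexive; ≤-trans; +-mono-≤; +-monoˡ-≤; +-monoʳ-≤; +-monoʳ-<; *-monoʳ-≤; <ᵇ⇒<;
         module ≤-Reasoning)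
open import Data.Nat.Tactic.RingSolver using (solve-∀)
open import Data.Product using (_×_; _,_; proj₁; proj₂)
open import Data.Sum using (_⊎_; inj₁; inj₂; assocˡ)
open import Data.Vec using ([]; _∷_; here; there; tabulate)
open import Data.Vec.Properties using (lookup⇒[]=; []=⇒lookup; lookup∘tabulate)
open import Function using (_∘_; Equivalence)
open import Relation.Binary.PropositionalEquality
open import Relation.Nullary using (¬_; Dec; yes; no; does; ¬?; contradiction)
open import Relation.Nullary.Decidable using (isYes≗does; dec-true; _⊎-dec_; _×-dec_)

∈-tabulate⁺ : ∀ {k} (g : Fin k → Bool) {i} → g i ≡ true → i ∈ tabulate g
∈-tabulate⁺ g {i} gi = lookup⇒[]= i (tabulate g) (trans (lookup∘tabulate g i) gi)

∈-tabulate⁻ : ∀ {k} (g : Fin k → Bool) {i} → i ∈ tabulate g → g i ≡ true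
∈-tabulate⁻ g {i} i∈ = trans (sym (lookup∘tabulate g i)) ([]=⇒lookup i∈)

does⇒witness : ∀ {A : Set} (a? : Dec A) → does a? ≡ true → A
does⇒witness (yes a) _ = a

∣p∩q∣+∣∁p∩q∣≡∣q∣ : ∀ {k} (p q : Subset k) → ∣ p ∩ q ∣ + ∣ ∁ p ∩ q ∣ ≡ ∣ q ∣
∣p∩q∣+∣∁p∩q∣≡∣q∣ []            []            = refl
∣p∩q∣+∣∁p∩q∣≡∣q∣ (inside  ∷ p) (inside  ∷ q) = cong suc (∣p∩q∣+∣∁p∩q∣≡∣q∣ p q)
∣p∩q∣+∣∁p∩q∣≡∣q∣ (outside ∷ p) (inside  ∷ q) =
  trans (+-suc _ _) (cong suc (∣p∩q∣+∣∁p∩q∣≡∣q∣ p q))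
∣p∩q∣+∣∁p∩q∣≡∣q∣ (inside  ∷ p) (outside ∷ q) = ∣p∩q∣+∣∁p∩q∣≡∣q∣ p q
∣p∩q∣+∣∁p∩q∣≡∣q∣ (outside ∷ p) (outside ∷ q) = ∣p∩q∣+∣∁p∩q∣≡∣q∣ p q

∣p∣+∣∁p∣≡n : ∀ {k} (p : Subset k) → ∣ p ∣ + ∣ ∁ p ∣ ≡ k
∣p∣+∣∁p∣≡n p = trans (cong (∣ p ∣ +_) (∣∁p∣≡n∸∣p∣ p)) (m+[n∸m]≡n (∣p∣≤n p))

∣p∪q∣≤∣p∣+∣q∣ : ∀ {k} (p q : Subset k) → ∣ p ∪ q ∣ ≤ ∣ p ∣ + ∣ q ∣
∣p∪q∣≤∣p∣+∣q∣ []            []            = z≤n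
∣p∪q∣≤∣p∣+∣q∣ (inside  ∷ p) (inside  ∷ q) =
  s≤s (≤-trans (∣p∪q∣≤∣p∣+∣q∣ p q) (+-monoʳ-≤ ∣ p ∣ (n≤1+n ∣ q ∣)))
∣p∪q∣≤∣p∣+∣q∣ (inside  ∷ p) (outside ∷ q) = s≤s (∣p∪q∣≤∣p∣+∣q∣ p q)
∣p∪q∣≤∣p∣+∣q∣ (outside ∷ p) (inside  ∷ q) =
  subst (suc ∣ p ∪ q ∣ ≤_) (sym (+-suc ∣ p ∣ ∣ q ∣)) (s≤s (∣p∪q∣≤∣p∣+∣q∣ p q))
∣p∪q∣≤∣p∣+∣q∣ (outside ∷ p) (outside ∷ q) = ∣p∪q∣≤∣p∣+∣q∣ p q

injection⇒∣p∣≤∣q∣ : ∀ {j k} {p : Subset j} {q : Subset k} (g : Fin j → Fin k) →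
  (∀ {x} → x ∈ p → g x ∈ q) →
  (∀ {x y} → x ∈ p → y ∈ p → g x ≡ g y → x ≡ y) → ∣ p ∣ ≤ ∣ q ∣
injection⇒∣p∣≤∣q∣ {p = []} g maps inj = z≤n
injection⇒∣p∣≤∣q∣ {p = outside ∷ p} g maps inj =
  injection⇒∣p∣≤∣q∣ (g ∘ suc) (maps ∘ there)
    (λ x∈ y∈ → Fin.suc-injective ∘ inj (there x∈) (there y∈))
injection⇒∣p∣≤∣q∣ {p = inside ∷ p} {q} g maps inj =
  ≤-trans (s≤s ∣p∣≤∣q-g0∣) (x∈p⇒∣p-x∣<∣p∣ (maps here))
  where
  ∣p∣≤∣q-g0∣ : ∣ p ∣ ≤ ∣ q - g zero ∣
  ∣p∣≤∣q-g0∣ = injection⇒∣p∣≤∣q∣ (g ∘ suc)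
    (λ x∈ → x∈p∧x≢y⇒x∈p-y (maps (there x∈))
              (λ g1≡g0 → Fin.0≢1+n (sym (inj (there x∈) here g1≡g0))))
    (λ x∈ y∈ → Fin.suc-injective ∘ inj (there x∈) (there y∈))

∑[_]_ : ∀ {k} → Subset k → (Fin k → ℕ) → ℕ
∑[ [] ]          f = 0
∑[ inside  ∷ p ] f = f zero + ∑[ p ] (f ∘ suc)
∑[ outside ∷ p ] f = ∑[ p ] (f ∘ suc)

⋃[_]_ : ∀ {j k} → Subset j → (Fin j → Subset k) → Subset k
⋃[ [] ]          A = ⊥
⋃[ inside  ∷ p ] A = A zero ∪ ⋃[ p ] (A ∘ suc)
⋃[ outside ∷ p ] A = ⋃[ p ] (A ∘ suc)

∈-⋃ : ∀ {j k} {p : Subset j} (A : Fin j → Subset k) {i x} → i ∈ p → x ∈ A i → x ∈ ⋃[ p ] A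
∈-⋃ {p = inside ∷ p} A here        x∈ = x∈p∪q⁺ (inj₁ x∈)
∈-⋃ {p = inside ∷ p} A (there i∈) x∈ = x∈p∪q⁺ (inj₂ (∈-⋃ (A ∘ suc) i∈ x∈))
∈-⋃ {p = outside ∷ p} A (there i∈) x∈ = ∈-⋃ (A ∘ suc) i∈ x∈

∣⋃∣≤∑∣∣ : ∀ {j k} (p : Subset j) (A : Fin j → Subset k) → ∣ ⋃[ p ] A ∣ ≤ ∑[ p ] (∣_∣ ∘ A)
∣⋃∣≤∑∣∣ {k = k} []   A = ≤-reflexive (∣⊥∣≡0 k)
∣⋃∣≤∑∣∣ (inside  ∷ p) A =
  ≤-trans (∣p∪q∣≤∣p∣+∣q∣ (A zero) _) (+-monoʳ-≤ ∣ A zero ∣ (∣⋃∣≤∑∣∣ p (A ∘ suc)))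
∣⋃∣≤∑∣∣ (outside ∷ p) A = ∣⋃∣≤∑∣∣ p (A ∘ suc)

∑-bounded : ∀ {k} (p : Subset k) {f : Fin k → ℕ} {c} →
  (∀ {i} → i ∈ p → f i ≤ c) → ∑[ p ] f ≤ ∣ p ∣ * c
∑-bounded []            f≤c = z≤n
∑-bounded (inside  ∷ p) f≤c = +-mono-≤ (f≤c here) (∑-bounded p (f≤c ∘ there))
∑-bounded (outside ∷ p) f≤c = ∑-bounded p (f≤c ∘ there)

∑-*ˡ : ∀ {k} (p : Subset k) (a : ℕ) (f : Fin k → ℕ) → ∑[ p ] (λ i → a * f i) ≡ a * ∑[ p ] f
∑-*ˡ []            a f = sym (*-zeroʳ a)
∑-*ˡ (inside  ∷ p) a f =
  trans (cong (a * f zero +_) (∑-*ˡ p a (f ∘ suc))) (sym (*-distribˡ-+ a (f zero) _))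
∑-*ˡ (outside ∷ p) a f = ∑-*ˡ p a (f ∘ suc)

∑-suc : ∀ {k} (p : Subset k) (f : Fin k → ℕ) → ∑[ p ] (suc ∘ f) ≡ ∣ p ∣ + ∑[ p ] f
∑-suc []            f = refl
∑-suc (inside  ∷ p) f = cong suc (begin
  f zero + ∑[ p ] (suc ∘ f ∘ suc)   ≡⟨ cong (f zero +_) (∑-suc p (f ∘ suc)) ⟩
  f zero + (∣ p ∣ + ∑[ p ] (f ∘ suc)) ≡⟨ x+[y+z]≡y+[x+z] (f zero) ∣ p ∣ _ ⟩
  ∣ p ∣ + (f zero + ∑[ p ] (f ∘ suc)) ∎)
  where
  open ≡-Reasoning
  x+[y+z]≡y+[x+z] : ∀ x y z → x + (y + z) ≡ y + (x + z)
  x+[y+z]≡y+[x+z] = solve-∀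
∑-suc (outside ∷ p) f = ∑-suc p (f ∘ suc)

module _ {k : ℕ} (adj : Fin k → Fin k → Bool)
         (adj-sym : ∀ {u v} → adj u v ≡ true → adj v u ≡ true) where

  ∣∁S∣≤∑degOut : ∀ {S} → Dominating adj S → ∣ ∁ S ∣ ≤ ∑[ S ] degOut adj S
  ∣∁S∣≤∑degOut {S} dom = ≤-trans (p⊆q⇒∣p∣≤∣q∣ covered) (∣⋃∣≤∑∣∣ S (λ u → ∁ S ∩ N adj u))
    where
    covered : ∁ S ⊆ ⋃[ S ] (λ u → ∁ S ∩ N adj u)
    covered {v} v∈∁S with dom v (x∈∁p⇒x∉p v∈∁S)
    ... | u , u∈S , vu =
      ∈-⋃ (λ u → ∁ S ∩ N adj u) u∈S (x∈p∩q⁺ (v∈∁S , ∈-tabulate⁺ (adj u) (adj-sym vu)))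

  dominating-bound : ∀ {S} c → Dominating adj S →
    (∀ {v} → v ∈ S → 2 * suc (degOut adj S v) ≤ c) → 2 * k ≤ ∣ S ∣ * c
  dominating-bound {S} c dom bound = begin
    2 * k                                     ≡⟨ cong (2 *_) (∣p∣+∣∁p∣≡n S) ⟨
    2 * (∣ S ∣ + ∣ ∁ S ∣)                     ≤⟨ *-monoʳ-≤ 2 (+-monoʳ-≤ ∣ S ∣ (∣∁S∣≤∑degOut dom)) ⟩
    2 * (∣ S ∣ + ∑[ S ] degOut adj S)         ≡⟨ cong (2 *_) (∑-suc S (degOut adj S)) ⟨
    2 * ∑[ S ] (suc ∘ degOut adj S)           ≡⟨ ∑-*ˡ S 2 (suc ∘ degOut adj S) ⟨
    ∑[ S ] (λ v → 2 * suc (degOut adj S v))   ≤⟨ ∑-bounded S bound ⟩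
    ∣ S ∣ * c                                 ∎
    where open ≤-Reasoning

  2*suc-degOut≤ : ∀ S v r → degOut adj S v ≤ degIn adj S v + r →
    2 * suc (degOut adj S v) ≤ ∣ N adj v ∣ + (2 + r)
  2*suc-degOut≤ S v r out≤in+r = begin
    2 * suc o             ≡⟨ 2*[1+o]≡o+[2+o] o ⟩
    o + (2 + o)           ≤⟨ +-monoʳ-≤ o (+-monoʳ-≤ 2 out≤in+r) ⟩
    o + (2 + (i + r))     ≡⟨ o+[2+[i+r]]≡i+o+[2+r] o i r ⟩
    (i + o) + (2 + r)     ≡⟨ cong (_+ (2 + r)) (∣p∩q∣+∣∁p∩q∣≡∣q∣ S (N adj v)) ⟩
    ∣ N adj v ∣ + (2 + r) ∎
    where
    open ≤-Reasoning
    o = degOut adj S v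
    i = degIn adj S v
    2*[1+o]≡o+[2+o] : ∀ o → 2 * suc o ≡ o + (2 + o)
    2*[1+o]≡o+[2+o] = solve-∀
    o+[2+[i+r]]≡i+o+[2+r] : ∀ o i r → o + (2 + (i + r)) ≡ (i + o) + (2 + r)
    o+[2+[i+r]]≡i+o+[2+r] = solve-∀

  globalDefensive-bound : ∀ {K S} → (∀ v → ∣ N adj v ∣ + 2 ≤ K) →
    IsGlobalDefensiveAlliance adj S → 2 * k ≤ ∣ S ∣ * (K + 1)
  globalDefensive-bound {K} {S} deg≤ ((_ , defended) , dom) =
    dominating-bound (K + 1) dom λ {v} v∈S → begin
      2 * suc (degOut adj S v) ≤⟨ 2*suc-degOut≤ S v 1 (defended v v∈S) ⟩
      ∣ N adj v ∣ + 3          ≡⟨ +-assoc ∣ N adj v ∣ 2 1 ⟨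
      ∣ N adj v ∣ + 2 + 1      ≤⟨ +-monoˡ-≤ 1 (deg≤ v) ⟩
      K + 1                    ∎
    where open ≤-Reasoning

  globalStrong-bound : ∀ {K S} → (∀ v → ∣ N adj v ∣ + 2 ≤ K) →
    IsGlobalStrongDefensiveAlliance adj S → 2 * k ≤ ∣ S ∣ * K
  globalStrong-bound {K} {S} deg≤ ((_ , defended) , dom) =
    dominating-bound K dom λ {v} v∈S →
      ≤-trans (2*suc-degOut≤ S v 0 (≤-trans (defended v v∈S) (m≤m+n _ 0))) (deg≤ v)

ceilDiv-least : ∀ a c s → a ≤ s * c → ceilDiv a c ≤ s
ceilDiv-least a zero    s _      = z≤n
ceilDiv-least a (suc b) s a≤s*c = s≤s⁻¹ (m<n*o⇒m/o<n (begin-strict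
  a + b             ≤⟨ +-monoˡ-≤ b a≤s*c ⟩
  s * suc b + b     <⟨ +-monoʳ-< (s * suc b) (n<1+n b) ⟩
  s * suc b + suc b ≡⟨ +-comm (s * suc b) (suc b) ⟩
  suc s * suc b     ∎))
  where open ≤-Reasoning

concatMap-unique : ∀ {A B : Set} {f : A → List B} (tag : B → A) →
  (∀ {x y} → y ∈ˡ f x → tag y ≡ x) → (∀ x → Unique (f x)) →
  ∀ {xs} → Unique xs → Unique (concatMap f xs)
concatMap-unique tag tagged f-unique [] = []
concatMap-unique {f = f} tag tagged f-unique {x ∷ xs} (x∉xs ∷ xs-unique) =
  ++⁺ (f-unique x) (concatMap-unique tag tagged f-unique xs-unique) disjoint
  where
  disjoint : ∀ {y} → ¬ (y ∈ˡ f x × y ∈ˡ concatMap f xs)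
  disjoint (y∈fx , y∈rest) with (x′ , x′∈xs , y∈fx′) ← find (∈-concatMap⁻ f y∈rest) =
    All.lookup x∉xs x′∈xs (trans (sym (tagged y∈fx)) (tagged y∈fx′))

lookup-injective : ∀ {A : Set} {xs : List A} → Unique xs →
  ∀ {i j} → lookup xs i ≡ lookup xs j → i ≡ j
lookup-injective {xs = _ ∷ _} _ {zero} {zero} _ = refl
lookup-injective (x∉xs ∷ _) {zero} {suc j} eq = contradiction eq (All.lookup x∉xs (∈-lookup j))
lookup-injective (x∉xs ∷ _) {suc i} {zero} eq = contradiction (sym eq) (All.lookup x∉xs (∈-lookup i))
lookup-injective (_ ∷ xs-unique) {suc i} {suc j} eq = cong suc (lookup-injective xs-unique eq)

module LineGraph (Γ : SimpleGraph) where
  open SimpleGraph Γ using (n; adj) renaming (sym to adj-comm)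

  adj-sym : ∀ {u v} → adj u v ≡ true → adj v u ≡ true
  adj-sym {u} {v} = trans (adj-comm v u)

  IsEdge : Fin n × Fin n → Set
  IsEdge (c , d) = c < d × adj c d ≡ true

  -- Spelled out so that edgeList Γ is definitionally concatMap edgesFrom (allFin n).
  candidate : Fin n → Fin n → List (Fin n × Fin n)
  candidate i j = if (toℕ i <ᵇ toℕ j) ∧ adj i j then (i , j) ∷ [] else []

  edgesFrom : Fin n → List (Fin n × Fin n)
  edgesFrom i = concatMap (candidate i) (allFin n)

  ∈-candidate : ∀ {i j p} → p ∈ˡ candidate i j → p ≡ (i , j) × IsEdge p
  ∈-candidate {i} {j} p∈ with toℕ i <ᵇ toℕ j in i<j | adj i j in ij
  ∈-candidate (Any.here refl) | true | true = refl , <ᵇ⇒< _ _ (Equivalence.from T-≡ i<j) , ij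

  candidate-unique : ∀ i j → Unique (candidate i j)
  candidate-unique i j with (toℕ i <ᵇ toℕ j) ∧ adj i j
  ... | true  = All.[] ∷ []
  ... | false = []

  ∈-edgesFrom : ∀ {i p} → p ∈ˡ edgesFrom i → proj₁ p ≡ i × IsEdge p
  ∈-edgesFrom {i} p∈ with (_ , p∈ij) ← satisfied (∈-concatMap⁻ (candidate i) {allFin n} p∈)
                      with refl , p-edge ← ∈-candidate p∈ij = refl , p-edge

  edgeList-unique : Unique (edgeList Γ)
  edgeList-unique = concatMap-unique proj₁ (proj₁ ∘ ∈-edgesFrom) edgesFrom-unique (allFin⁺ n)
    where
    edgesFrom-unique : ∀ i → Unique (edgesFrom i)
    edgesFrom-unique i = concatMap-unique proj₂ (cong proj₂ ∘ proj₁ ∘ ∈-candidate)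
                           (candidate-unique i) (allFin⁺ n)

  edge-isEdge : ∀ f → IsEdge (edge Γ f)
  edge-isEdge f
    with (_ , p∈) ← satisfied (∈-concatMap⁻ edgesFrom {allFin n} (∈-lookup {xs = edgeList Γ} f)) =
    proj₂ (∈-edgesFrom p∈)

  edge-injective : ∀ {f g} → edge Γ f ≡ edge Γ g → f ≡ g
  edge-injective = lookup-injective edgeList-unique

  Incident : Fin n → Fin n × Fin n → Set
  Incident x (c , d) = x ≡ c ⊎ x ≡ d

  incident? : ∀ x p → Dec (Incident x p)
  incident? x (c , d) = x ≟ c ⊎-dec x ≟ d

  opposite : Fin n → Fin n × Fin n → Fin n
  opposite x (c , d) = if does (x ≟ c) then d else c

  opposite-adjacent : ∀ {x p} → IsEdge p → Incident x p → adj x (opposite x p) ≡ true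
  opposite-adjacent {x} {c , d} (_ , cd) x∈p with x ≟ c | x∈p
  ... | yes refl | _         = cd
  ... | no x≢c   | inj₁ x≡c  = contradiction x≡c x≢c
  ... | no _     | inj₂ refl = adj-sym cd

  opposite-injective : ∀ {x p q} → IsEdge p → IsEdge q → Incident x p → Incident x q →
    opposite x p ≡ opposite x q → p ≡ q
  opposite-injective {x} {c , d} {c′ , d′} (c<d , _) (c′<d′ , _) x∈p x∈q same
    with x ≟ c | x ≟ c′ | x∈p | x∈q
  ... | yes refl | yes refl | _         | _         = cong (x ,_) same
  ... | yes refl | no x≢c′  | _         | inj₁ x≡c′ = contradiction x≡c′ x≢c′
  ... | yes refl | no _     | _         | inj₂ refl =
    contradiction (subst (_< x) (sym same) c′<d′) (Fin.<-asym c<d)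
  ... | no x≢c   | _        | inj₁ x≡c  | _         = contradiction x≡c x≢c
  ... | no _     | yes refl | inj₂ refl | _         =
    contradiction (subst (_< x) same c<d) (Fin.<-asym c′<d′)
  ... | no _     | no x≢c′  | inj₂ refl | inj₁ x≡c′ = contradiction x≡c′ x≢c′
  ... | no _     | no _     | inj₂ refl | inj₂ refl = cong (_, x) same

  star : Fin n → Subset (size Γ)
  star x = tabulate (λ f → does (incident? x (edge Γ f)))

  ∈-star⁻ : ∀ {x f} → f ∈ star x → Incident x (edge Γ f)
  ∈-star⁻ {x} {f} f∈ = does⇒witness (incident? x (edge Γ f)) (∈-tabulate⁻ _ f∈)

  ∈-star⁺ : ∀ {x f} → Incident x (edge Γ f) → f ∈ star x
  ∈-star⁺ {x} {f} x∈f = ∈-tabulate⁺ _ (dec-true (incident? x (edge Γ f)) x∈f)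

  ∣star∣≤degree : ∀ x → ∣ star x ∣ ≤ degree Γ x
  ∣star∣≤degree x = injection⇒∣p∣≤∣q∣ (λ f → opposite x (edge Γ f))
    (λ f∈ → ∈-tabulate⁺ (adj x) (opposite-adjacent (edge-isEdge _) (∈-star⁻ {x} f∈)))
    (λ f∈ g∈ same → edge-injective (opposite-injective (edge-isEdge _) (edge-isEdge _)
                                      (∈-star⁻ {x} f∈) (∈-star⁻ {x} g∈) same))

  SharesEnd : Fin n × Fin n → Fin n × Fin n → Set
  SharesEnd (a , b) (c , d) = a ≡ c ⊎ a ≡ d ⊎ b ≡ c ⊎ b ≡ d

  sharesEnd? : ∀ p q → Dec (SharesEnd p q)
  sharesEnd? (a , b) (c , d) = a ≟ c ⊎-dec a ≟ d ⊎-dec b ≟ c ⊎-dec b ≟ d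

  sharesEnd-sym : ∀ {p q} → SharesEnd p q → SharesEnd q p
  sharesEnd-sym {_ , _} {_ , _} (inj₁ refl)                 = inj₁ refl
  sharesEnd-sym {_ , _} {_ , _} (inj₂ (inj₁ refl))          = inj₂ (inj₂ (inj₁ refl))
  sharesEnd-sym {_ , _} {_ , _} (inj₂ (inj₂ (inj₁ refl)))   = inj₂ (inj₁ refl)
  sharesEnd-sym {_ , _} {_ , _} (inj₂ (inj₂ (inj₂ refl)))   = inj₂ (inj₂ (inj₂ refl))

  LineAdjacent : Fin (size Γ) → Fin (size Γ) → Set
  LineAdjacent e f = e ≢ f × SharesEnd (edge Γ e) (edge Γ f)

  lineAdjacent? : ∀ e f → Dec (LineAdjacent e f)
  lineAdjacent? e f = ¬? (e ≟ f) ×-dec sharesEnd? (edge Γ e) (edge Γ f)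

  -- Needed because ⌊_⌋ is isYes, which does not reduce to does on an undetermined decision.
  shareEnd≡does : ∀ p q → shareEnd Γ p q ≡ does (sharesEnd? p q)
  shareEnd≡does (a , b) (c , d)
    rewrite isYes≗does (a ≟ c) | isYes≗does (a ≟ d) | isYes≗does (b ≟ c) | isYes≗does (b ≟ d) = refl

  lineAdj≡does : ∀ e f → lineAdj Γ e f ≡ does (lineAdjacent? e f)
  lineAdj≡does e f rewrite isYes≗does (e ≟ f) | shareEnd≡does (edge Γ e) (edge Γ f) = refl

  lineAdj⇒LineAdjacent : ∀ {e f} → lineAdj Γ e f ≡ true → LineAdjacent e f
  lineAdj⇒LineAdjacent {e} {f} = does⇒witness (lineAdjacent? e f) ∘ trans (sym (lineAdj≡does e f))

  LineAdjacent⇒lineAdj : ∀ {e f} → LineAdjacent e f → lineAdj Γ e f ≡ true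
  LineAdjacent⇒lineAdj {e} {f} = trans (lineAdj≡does e f) ∘ dec-true (lineAdjacent? e f)

  lineAdj-sym : ∀ {e f} → lineAdj Γ e f ≡ true → lineAdj Γ f e ≡ true
  lineAdj-sym e~f with (e≢f , shared) ← lineAdj⇒LineAdjacent e~f =
    LineAdjacent⇒lineAdj (e≢f ∘ sym , sharesEnd-sym shared)

  N-lineAdj⊆ : ∀ e → let (a , b) = edge Γ e in N (lineAdj Γ) e ⊆ (star a - e) ∪ (star b - e)
  N-lineAdj⊆ e {f} f∈ with (e≢f , shared) ← lineAdj⇒LineAdjacent (∈-tabulate⁻ _ f∈)
    with assocˡ shared
  ... | inj₁ a∈f = x∈p∪q⁺ (inj₁ (x∈p∧x≢y⇒x∈p-y (∈-star⁺ a∈f) (e≢f ∘ sym)))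
  ... | inj₂ b∈f = x∈p∪q⁺ (inj₂ (x∈p∧x≢y⇒x∈p-y (∈-star⁺ b∈f) (e≢f ∘ sym)))

  lineDegree+2≤ : ∀ e → let (a , b) = edge Γ e in
    ∣ N (lineAdj Γ) e ∣ + 2 ≤ degree Γ a + degree Γ b
  lineDegree+2≤ e = begin
    ∣ N (lineAdj Γ) e ∣ + 2                 ≤⟨ +-monoˡ-≤ 2 (≤-trans (p⊆q⇒∣p∣≤∣q∣ (N-lineAdj⊆ e))
                                                             (∣p∪q∣≤∣p∣+∣q∣ (star a - e) _)) ⟩
    ∣ star a - e ∣ + ∣ star b - e ∣ + 2     ≡⟨ x+y+2≡1+x+1+y ∣ star a - e ∣ ∣ star b - e ∣ ⟩
    suc ∣ star a - e ∣ + suc ∣ star b - e ∣ ≤⟨ +-mono-≤ (x∈p⇒∣p-x∣<∣p∣ (∈-star⁺ (inj₁ refl)))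
                                                        (x∈p⇒∣p-x∣<∣p∣ (∈-star⁺ (inj₂ refl))) ⟩
    ∣ star a ∣ + ∣ star b ∣                 ≤⟨ +-mono-≤ (∣star∣≤degree a) (∣star∣≤degree b) ⟩
    degree Γ a + degree Γ b                 ∎
    where
    open ≤-Reasoning
    a = proj₁ (edge Γ e)
    b = proj₂ (edge Γ e)
    x+y+2≡1+x+1+y : ∀ x y → x + y + 2 ≡ suc x + suc y
    x+y+2≡1+x+1+y = solve-∀

  topTwo-sum : ∀ {δ₁ δ₂} → TopTwoDegrees Γ δ₁ δ₂ →
    ∀ {a b} → a ≢ b → degree Γ a + degree Γ b ≤ δ₁ + δ₂
  topTwo-sum {δ₁} {δ₂} (u , _ , _ , _ , _ , ≤δ₁ , ≤δ₂) {a} {b} a≢b with a ≟ u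
  ... | yes refl = +-mono-≤ (≤δ₁ a) (≤δ₂ b (a≢b ∘ sym))
  ... | no a≢u   =
    subst (_≤ δ₁ + δ₂) (+-comm (degree Γ b) (degree Γ a)) (+-mono-≤ (≤δ₁ b) (≤δ₂ a a≢u))

  lineDegree+2≤δ₁+δ₂ : ∀ {δ₁ δ₂} → TopTwoDegrees Γ δ₁ δ₂ →
    ∀ e → ∣ N (lineAdj Γ) e ∣ + 2 ≤ δ₁ + δ₂
  lineDegree+2≤δ₁+δ₂ top e =
    ≤-trans (lineDegree+2≤ e) (topTwo-sum top (Fin.<⇒≢ (proj₁ (edge-isEdge e))))

open LineGraph using (lineAdj-sym; lineDegree+2≤δ₁+δ₂)

mainTheorem7 : (Γ : SimpleGraph) (δ₁ δ₂ : ℕ) → TopTwoDegrees Γ δ₁ δ₂ →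
    ((S : Subset (size Γ)) → IsGlobalDefensiveAlliance (lineAdj Γ) S →
      ceilDiv (2 * size Γ) (δ₁ + δ₂ + 1) ≤ ∣ S ∣)
    × ((S : Subset (size Γ)) → IsGlobalStrongDefensiveAlliance (lineAdj Γ) S →
      ceilDiv (2 * size Γ) (δ₁ + δ₂) ≤ ∣ S ∣)
mainTheorem7 Γ δ₁ δ₂ top =
  (λ _ alliance → ceilDiv-least _ _ _
     (globalDefensive-bound (lineAdj Γ) (lineAdj-sym Γ) lineDegree≤ alliance)) ,
  (λ _ alliance → ceilDiv-least _ _ _
     (globalStrong-bound (lineAdj Γ) (lineAdj-sym Γ) lineDegree≤ alliance))
  where
  lineDegree≤ : ∀ e → ∣ N (lineAdj Γ) e ∣ + 2 ≤ δ₁ + δ₂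
  lineDegree≤ = lineDegree+2≤δ₁+δ₂ Γ top
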